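{- Let $G$ be a finite simple graph on $n = |V(G)| \geq 3$ vertices, and let $r$ be an integer with $n-2 \leq r \leq n-1$. Then the $r$-independence complex $\mathrm{Ind}_r(G)$ is shellable.
   Context: For a graph $G$ and integer $r \geq 1$, a subset $A \subseteq V(G)$ is $r$-independent if every connected component of the induced subgraph $G[A]$ has at most $r$ vertices. The $r$-independence complex $\mathrm{Ind}_r(G)$ is the simplicial complex on $V(G)$ whose faces are the $r$-independent subsets of $V(G)$. A (not necessarily pure) simplicial complex $\Delta$ is shellable if its facets can be ordered $F_1, \dots, F_t$ so that for each $k > 1$ the complex $\langle F_k \rangle \cap \langle F_1, \dots, F_{k-1}\rangle$ is pure of dimension $\dim F_k - 1$, where $\langle \mathcal{F}\rangle$ denotes the simplicial complex generated by the sets in $\mathcal{F}$. -}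

module Defs where

open import Data.Nat using (ℕ; suc; _+_; _≤_; _<_)
open import Data.Bool using (Bool; true; false)
open import Data.Fin using (Fin; toℕ)
open import Data.Fin.Subset using (Subset; _∈_; _⊆_; ∣_∣)
open import Data.Product using (Σ; _×_; ∃-syntax)
open import Function.Definitions using (Injective)
open import Relation.Binary.PropositionalEquality using (_≡_)

record SimpleGraph (n : ℕ) : Set where
  field
    adj    : Fin n → Fin n → Bool
    sym    : ∀ u v → adj u v ≡ adj v u
    irrefl : ∀ v → adj v v ≡ false
open SimpleGraph public

data Reach {n : ℕ} (G : SimpleGraph n) (A : Subset n) : Fin n → Fin n → Set where
  here : ∀ {u} → u ∈ A → Reach G A u u
  step : ∀ {u v w} → Reach G A u v → w ∈ A → adj G v w ≡ true → Reach G A u w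

-- A is r-independent: every connected component of G[A] has at most r vertices.
-- (The component of v ∈ A is the set of vertices reachable from v in G[A];
-- it has at most r vertices iff every set of vertices in it has at most r elements.)
RIndependent : {n : ℕ} → SimpleGraph n → ℕ → Subset n → Set
RIndependent {n} G r A =
  ∀ v → v ∈ A → ∀ (S : Subset n) → (∀ u → u ∈ S → Reach G A v u) → ∣ S ∣ ≤ r

Complex : ℕ → Set₁
Complex n = Subset n → Set

Ind : {n : ℕ} → SimpleGraph n → ℕ → Complex n
Ind G r = RIndependent G r

IsFacet : {n : ℕ} → Complex n → Subset n → Set
IsFacet Δ σ = Δ σ × (∀ τ → Δ τ → σ ⊆ τ → τ ≡ σ)

PrefixIntersection : {n t : ℕ} → (Fin t → Subset n) → Fin t → Complex n
PrefixIntersection F k σ = σ ⊆ F k × ∃[ j ] (toℕ j < toℕ k × σ ⊆ F j)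

-- A shelling: an enumeration F of the facets of Δ (each exactly once) such that
-- for each k > 1 (0-indexed: toℕ k > 0), ⟨F k⟩ ∩ ⟨F_1..F_{k-1}⟩ is pure of
-- dimension dim F k - 1, i.e. all its facets have cardinality ∣ F k ∣ - 1.
IsShelling : {n t : ℕ} → Complex n → (Fin t → Subset n) → Set
IsShelling {n} {t} Δ F =
  Injective _≡_ _≡_ F
  × (∀ i → IsFacet Δ (F i))
  × (∀ σ → IsFacet Δ σ → ∃[ i ] (F i ≡ σ))
  × (∀ k → 0 < toℕ k → ∀ σ → IsFacet (PrefixIntersection F k) σ → suc ∣ σ ∣ ≡ ∣ F k ∣)

Shellable : {n : ℕ} → Complex n → Set
Shellable {n} Δ = ∃[ t ] Σ (Fin t → Subset n) (IsShelling Δ)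

-- Since r ≥ n − 2, every vertex set V − a − b (a ≠ b) is r-independent. If V itself is a
-- face it is the only facet. Otherwise the facets are the faces V − v together with the sets
-- V − a − b for which neither V − a nor V − b is a face. List the former first and the latter
-- colexicographically in {a, b}. For a facet F and an earlier facet F′ there is a vertex
-- x ∈ F ∖ F′ such that F − x lies in an earlier facet: V − x if that is a face, and otherwise
-- V − a − x, which precedes V − a − b because x < b. Hence ⟨F⟩ ∩ ⟨earlier facets⟩ is generated
-- by sets F − x, all of size |F| − 1. Listing the facets requires r-independence to be
-- decidable, which holds because connected components are computable as closures.
module Submission where

open import Defs hiding (sym)
open import Data.Bool using (true)
import Data.Bool.Properties as Bool
open import Data.Empty using (⊥-elim)
open import Data.Fin as Fin using (Fin; zero; suc; toℕ; combine)
import Data.Fin.Properties as Fin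
open import Data.Fin.Subset using (Subset; _∈_; _∉_; _⊆_; ∣_∣; ⊤; ⁅_⁆; _-_; inside; outside)
open import Data.Fin.Subset.Properties
  using (_∈?_; _⊆?_; ⊆-antisym; ∈⊤; ∣⊤∣≡n; x∈⁅x⁆; x∈⁅y⁆⇒x≡y; ∣⁅x⁆∣≡1; ∣p∣≤n;
         p⊆q⇒∣p∣≤∣q∣; p⊂q⇒∣p∣<∣q∣; x∈p∧x≢y⇒x∈p-y; p─q⊆p; p─⊥≡p; p─x─y≡p─y─x)
open import Data.List using (List; filter; upTo; length; lookup)
open import Data.List.Membership.Propositional.Properties
  using (∈-filter⁻; ∈-filter⁺; ∈-upTo⁺; ∈-lookup)
open import Data.List.Relation.Unary.All as All using ()
open import Data.List.Relation.Unary.AllPairs using (AllPairs; _∷_)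
import Data.List.Relation.Unary.AllPairs.Properties as AllPairs
open import Data.List.Relation.Unary.Any using (index)
open import Data.List.Relation.Unary.Any.Properties using (lookup-index)
open import Data.Nat as ℕ using (ℕ; zero; suc; _+_; _*_; _∸_; _≤_; _<_; s<s)
import Data.Nat.Properties as ℕ
open import Data.Product using (∃; ∃-syntax; _×_; _,_; proj₁; proj₂)
open import Data.Sum using (_⊎_; inj₁; inj₂)
open import Data.Vec using (_∷_; tabulate; here; there)
open import Function using (_∘_; const; flip)
open import Level using (Level)
open import Relation.Binary using (tri<; tri≈; tri>)
open import Relation.Binary.PropositionalEquality
  using (_≡_; _≢_; refl; sym; trans; cong; subst; subst₂; module ≡-Reasoning)
open import Relation.Nullary using (Dec; yes; no; does; ¬_; contradiction)
open import Relation.Nullary.Decidable using (_×-dec_; _⊎-dec_; _→-dec_; ¬?; map′; decidable-stable)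
open import Relation.Unary using (Pred; Decidable)

private variable
  a ℓ : Level
  A : Set a
  n t : ℕ

⟦_⟧ : {P : Pred (Fin n) ℓ} → Decidable P → Subset n
⟦ P? ⟧ = tabulate (does ∘ P?)

∈⟦⟧⁺ : {P : Pred (Fin n) ℓ} (P? : Decidable P) → ∀ {x} → P x → x ∈ ⟦ P? ⟧
∈⟦⟧⁺ P? {zero} px with P? zero
... | yes _ = here
... | no ¬px = contradiction px ¬px
∈⟦⟧⁺ P? {suc x} px = there (∈⟦⟧⁺ (P? ∘ suc) px)

∈⟦⟧⁻ : {P : Pred (Fin n) ℓ} (P? : Decidable P) → ∀ {x} → x ∈ ⟦ P? ⟧ → P x
∈⟦⟧⁻ P? {zero} x∈ with P? zero | x∈
... | yes px | _ = px
∈⟦⟧⁻ P? {suc x} (there x∈) = ∈⟦⟧⁻ (P? ∘ suc) x∈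

x∈p-y⇒x≢y : ∀ {p : Subset n} {x y} → x ∈ p - y → x ≢ y
x∈p-y⇒x≢y {p = _ ∷ _} {zero}  ()         refl
x∈p-y⇒x≢y {p = _ ∷ _} {suc x} (there x∈) refl = x∈p-y⇒x≢y x∈ refl

x∈p-y⇒x∈p : ∀ {p : Subset n} {x y} → x ∈ p - y → x ∈ p
x∈p-y⇒x∈p {p = p} {y = y} = p─q⊆p p ⁅ y ⁆

∣p-x∣+1≡∣p∣ : ∀ {p : Subset n} {x} → x ∈ p → suc ∣ p - x ∣ ≡ ∣ p ∣
∣p-x∣+1≡∣p∣ {p = inside ∷ p} {zero} here = cong suc (cong ∣_∣ (p─⊥≡p p))
∣p-x∣+1≡∣p∣ {p = inside ∷ p} {suc x} (there x∈) = cong suc (∣p-x∣+1≡∣p∣ x∈)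
∣p-x∣+1≡∣p∣ {p = outside ∷ p} {suc x} (there x∈) = ∣p-x∣+1≡∣p∣ x∈

∈⊤-x : ∀ {x y : Fin n} → y ≢ x → y ∈ ⊤ - x
∈⊤-x y≢x = x∈p∧x≢y⇒x∈p-y ∈⊤ y≢x

∈⊤-x-y : ∀ {x y z : Fin n} → z ≢ x → z ≢ y → z ∈ ⊤ - x - y
∈⊤-x-y z≢x z≢y = x∈p∧x≢y⇒x∈p-y (∈⊤-x z≢x) z≢y

∣⊤-x-y∣≡n∸2 : ∀ {x y : Fin n} → x ≢ y → ∣ ⊤ - x - y ∣ ≡ n ∸ 2
∣⊤-x-y∣≡n∸2 {n} {x} {y} x≢y = cong (_∸ 2) (begin
  suc (suc ∣ ⊤ - x - y ∣)  ≡⟨ cong suc (∣p-x∣+1≡∣p∣ (∈⊤-x (x≢y ∘ sym))) ⟩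
  suc ∣ ⊤ - x ∣            ≡⟨ ∣p-x∣+1≡∣p∣ {x = x} ∈⊤ ⟩
  ∣ ⊤ {n} ∣                ≡⟨ ∣⊤∣≡n n ⟩
  n                        ∎)
  where open ≡-Reasoning

⊆⊤-x : ∀ {τ : Subset n} {x} → x ∉ τ → τ ⊆ ⊤ - x
⊆⊤-x x∉τ y∈τ = ∈⊤-x λ { refl → x∉τ y∈τ }

⊆-insert : ∀ {p τ : Subset n} {x} → p - x ⊆ τ → x ∈ τ → p ⊆ τ
⊆-insert {x = x} p-x⊆τ x∈τ {y} y∈p with y Fin.≟ x
... | yes refl = x∈τ
... | no  y≢x  = p-x⊆τ (x∈p∧x≢y⇒x∈p-y y∈p y≢x)

⊆-drop-middle : ∀ {p : Subset n} {a b x} → p - a - b - x ⊆ p - a - x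
⊆-drop-middle y∈ = x∈p∧x≢y⇒x∈p-y (x∈p-y⇒x∈p (x∈p-y⇒x∈p y∈)) (x∈p-y⇒x≢y y∈)

⊈⇒∃∉ : ∀ {p q : Subset n} → ¬ p ⊆ q → ∃[ x ] (x ∈ p × x ∉ q)
⊈⇒∃∉ {n} {p} {q} p⊈q
  with Fin.¬∀⟶∃¬ n (λ x → x ∈ p → x ∈ q) (λ x → x ∈? p →-dec x ∈? q) (λ p⊆q → p⊈q (p⊆q _))
... | x , x∈p↛x∈q =
  x , decidable-stable (x ∈? p) (λ x∉p → x∈p↛x∈q (flip contradiction x∉p)) , x∈p↛x∈q ∘ const

module Component {n} (G : SimpleGraph n) (A : Subset n) where

  Closed : Subset n → Set
  Closed R = ∀ {u w} → u ∈ R → w ∈ A → adj G u w ≡ true → w ∈ R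

  Extension : Subset n → Fin n → Set
  Extension R w = w ∈ R ⊎ (w ∈ A × ∃[ u ] (u ∈ R × adj G u w ≡ true))

  extension? : ∀ R → Decidable (Extension R)
  extension? R w = w ∈? R ⊎-dec (w ∈? A ×-dec Fin.any? (λ u → u ∈? R ×-dec adj G u w Bool.≟ true))

  extend : Subset n → Subset n
  extend R = ⟦ extension? R ⟧

  ⊆-extend : ∀ {R} → R ⊆ extend R
  ⊆-extend {R} x∈R = ∈⟦⟧⁺ (extension? R) (inj₁ x∈R)

  extend-stable⇒Closed : ∀ {R} → extend R ⊆ R → Closed R
  extend-stable⇒Closed {R} stable u∈R w∈A uw =
    stable (∈⟦⟧⁺ (extension? R) (inj₂ (w∈A , _ , u∈R , uw)))

  extend-grows : ∀ {R} → ¬ extend R ⊆ R → ∣ R ∣ < ∣ extend R ∣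
  extend-grows unstable with ⊈⇒∃∉ unstable
  ... | x , x∈ , x∉ = p⊂q⇒∣p∣<∣q∣ (⊆-extend , x , x∈ , x∉)

  closure : ℕ → Subset n → Subset n
  closure zero    R = R
  closure (suc k) R with extend R ⊆? R
  ... | yes _ = R
  ... | no  _ = closure k (extend R)

  closure-preserves : (P : Subset n → Set) → (∀ {R} → P R → P (extend R)) →
                      ∀ k {R} → P R → P (closure k R)
  closure-preserves P preserve zero    pR = pR
  closure-preserves P preserve (suc k) {R} pR with extend R ⊆? R
  ... | yes _ = pR
  ... | no  _ = closure-preserves P preserve k (preserve pR)

  closure-closed : ∀ k R → n < k + ∣ R ∣ → Closed (closure k R)
  closure-closed zero    R n<∣R∣ = contradiction (∣p∣≤n R) (ℕ.<⇒≱ n<∣R∣)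
  closure-closed (suc k) R n<k+1+∣R∣ with extend R ⊆? R
  ... | yes stable   = extend-stable⇒Closed stable
  ... | no  unstable = closure-closed k (extend R)
        (ℕ.<-≤-trans n<k+1+∣R∣
          (subst (_≤ k + ∣ extend R ∣) (ℕ.+-suc k ∣ R ∣) (ℕ.+-monoʳ-≤ k (extend-grows unstable))))

  component : Fin n → Subset n
  component v = closure n ⁅ v ⁆

  module _ {v} (v∈A : v ∈ A) where

    ∈component⇒Reach : ∀ {w} → w ∈ component v → Reach G A v w
    ∈component⇒Reach = closure-preserves (λ R → ∀ {w} → w ∈ R → Reach G A v w) reach-extend n
      (λ w∈⁅v⁆ → subst (Reach G A v) (sym (x∈⁅y⁆⇒x≡y v w∈⁅v⁆)) (here v∈A))
      where
      reach-extend : ∀ {R} → (∀ {w} → w ∈ R → Reach G A v w) →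
                     ∀ {w} → w ∈ extend R → Reach G A v w
      reach-extend {R} reachR w∈ with ∈⟦⟧⁻ (extension? R) w∈
      ... | inj₁ w∈R = reachR w∈R
      ... | inj₂ (w∈A , u , u∈R , uw) = step (reachR u∈R) w∈A uw

    component-closed : Closed (component v)
    component-closed =
      closure-closed n ⁅ v ⁆ (subst (λ m → n < n + m) (sym (∣⁅x⁆∣≡1 v)) (ℕ.m<m+n n ℕ.z<s))

    Reach⇒∈component : ∀ {w} → Reach G A v w → w ∈ component v
    Reach⇒∈component (here _)        = closure-preserves (v ∈_) ⊆-extend n (x∈⁅x⁆ v)
    Reach⇒∈component (step r w∈A uw) = component-closed (Reach⇒∈component r) w∈A uw

RIndependent? : ∀ (G : SimpleGraph n) r → Decidable (RIndependent G r)
RIndependent? G r A =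
  map′ small⇒independent independent⇒small (Fin.all? λ v → v ∈? A →-dec ∣ component v ∣ ℕ.≤? r)
  where
  open Component G A
  small⇒independent : (∀ v → v ∈ A → ∣ component v ∣ ≤ r) → RIndependent G r A
  small⇒independent small v v∈A S S-reached =
    ℕ.≤-trans (p⊆q⇒∣p∣≤∣q∣ (λ u∈S → Reach⇒∈component v∈A (S-reached _ u∈S))) (small v v∈A)
  independent⇒small : RIndependent G r A → ∀ v → v ∈ A → ∣ component v ∣ ≤ r
  independent⇒small independent v v∈A = independent v v∈A (component v) (λ _ → ∈component⇒Reach v∈A)

∣A∣≤r⇒RIndependent : ∀ (G : SimpleGraph n) {r A} → ∣ A ∣ ≤ r → RIndependent G r A
∣A∣≤r⇒RIndependent G ∣A∣≤r v v∈A S S-reached =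
  ℕ.≤-trans (p⊆q⇒∣p∣≤∣q∣ (Reach-⊆ ∘ S-reached _)) ∣A∣≤r
  where
  Reach-⊆ : ∀ {A u w} → Reach G A u w → w ∈ A
  Reach-⊆ (here w∈A)     = w∈A
  Reach-⊆ (step _ w∈A _) = w∈A

AllPairs-lookup : ∀ {R : A → A → Set ℓ} {xs} → AllPairs R xs →
                  ∀ {i j} → toℕ i < toℕ j → R (lookup xs i) (lookup xs j)
AllPairs-lookup (Rx ∷ _)  {zero}  {suc j} _         = All.lookup Rx (∈-lookup j)
AllPairs-lookup (_ ∷ Rxs) {suc i} {suc j} (s<s i<j) = AllPairs-lookup Rxs i<j

module IncreasingEnumeration {P : Pred ℕ ℓ} (P? : Decidable P) (N : ℕ) where

  private
    elements : List ℕ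
    elements = filter P? (upTo N)

  size : ℕ
  size = length elements

  nth : Fin size → ℕ
  nth = lookup elements

  nth-satisfies : ∀ i → P (nth i)
  nth-satisfies i = proj₂ (∈-filter⁻ P? {xs = upTo N} (∈-lookup i))

  nth-strictlyIncreasing : ∀ {i j} → toℕ i < toℕ j → nth i < nth j
  nth-strictlyIncreasing =
    AllPairs-lookup (AllPairs.filter⁺ P? (AllPairs.applyUpTo⁺₁ (λ m → m) N (λ i<j _ → i<j)))

  nth-surjective : ∀ {m} → P m → m < N → ∃[ i ] nth i ≡ m
  nth-surjective Pm m<N = index m∈ , sym (lookup-index m∈)
    where m∈ = ∈-filter⁺ P? (∈-upTo⁺ m<N) Pm

Exchange : (Fin t → Subset n) → Set
Exchange {t} {n} F =
  ∀ {j k : Fin t} → toℕ j < toℕ k →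
  ∃[ x ] (x ∈ F k × x ∉ F j × ∃[ i ] (toℕ i < toℕ k × F k - x ⊆ F i))

module _ {F : Fin t → Subset n} (exchange : Exchange F) where

  Exchange⇒injective : ∀ {i j} → F i ≡ F j → i ≡ j
  Exchange⇒injective {i} {j} Fi≡Fj with Fin.<-cmp i j
  ... | tri< i<j _ _ = let (x , x∈Fj , x∉Fi , _) = exchange i<j
                       in contradiction (subst (x ∈_) (sym Fi≡Fj) x∈Fj) x∉Fi
  ... | tri≈ _ i≡j _ = i≡j
  ... | tri> _ _ j<i = let (x , x∈Fi , x∉Fj , _) = exchange j<i
                       in contradiction (subst (x ∈_) Fi≡Fj x∈Fi) x∉Fj

  Exchange⇒pure : ∀ k σ → IsFacet (PrefixIntersection F k) σ → suc ∣ σ ∣ ≡ ∣ F k ∣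
  Exchange⇒pure k σ ((σ⊆Fk , j , j<k , σ⊆Fj) , maximal) with exchange j<k
  ... | x , x∈Fk , x∉Fj , i , i<k , Fk-x⊆Fi = begin
    suc ∣ σ ∣          ≡⟨ cong (suc ∘ ∣_∣) (sym Fk-x≡σ) ⟩
    suc ∣ F k - x ∣    ≡⟨ ∣p-x∣+1≡∣p∣ x∈Fk ⟩
    ∣ F k ∣            ∎
    where
    open ≡-Reasoning
    Fk-x≡σ : F k - x ≡ σ
    Fk-x≡σ = maximal (F k - x) (x∈p-y⇒x∈p , i , i<k , Fk-x⊆Fi)
      (λ y∈σ → x∈p∧x≢y⇒x∈p-y (σ⊆Fk y∈σ) λ { refl → x∉Fj (σ⊆Fj y∈σ) })

Exchange⇒IsShelling : ∀ {Δ : Complex n} {F : Fin t → Subset n} →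
  (∀ i → IsFacet Δ (F i)) → (∀ σ → IsFacet Δ σ → ∃[ i ] F i ≡ σ) → Exchange F →
  IsShelling Δ F
Exchange⇒IsShelling facets complete exchange =
  Exchange⇒injective exchange , facets , complete , λ k _ → Exchange⇒pure exchange k

⊤-face⇒Shellable : ∀ {Δ : Complex n} → Δ ⊤ → Shellable Δ
⊤-face⇒Shellable {Δ = Δ} Δ⊤ =
  1 , (λ _ → ⊤) , Exchange⇒IsShelling (λ _ → ⊤-facet) ⊤-unique λ { {k = zero} () ; {k = suc ()} }
  where
  ⊤-facet : IsFacet Δ ⊤
  ⊤-facet = Δ⊤ , λ τ _ ⊤⊆τ → ⊆-antisym (λ _ → ∈⊤) ⊤⊆τ
  ⊤-unique : ∀ σ → IsFacet Δ σ → ∃[ i ] ⊤ ≡ σ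
  ⊤-unique σ (_ , maximal) = zero , maximal ⊤ Δ⊤ (λ _ → ∈⊤)

data Deletion (n : ℕ) : Set where
  single : Fin n → Deletion n
  pair   : Fin n → Fin n → Deletion n

any-Deletion? : {P : Deletion n → Set} → (∀ d → Dec (P d)) → Dec (∃ P)
any-Deletion? P? with Fin.any? (P? ∘ single) | Fin.any? (λ a → Fin.any? (P? ∘ pair a))
... | yes (v , Pv)   | _                   = yes (single v , Pv)
... | no _           | yes (a , b , Pab)   = yes (pair a b , Pab)
... | no ¬single     | no ¬pair            =
  no λ { (single v , Pv) → ¬single (v , Pv) ; (pair a b , Pab) → ¬pair (a , b , Pab) }

-- Single deletions come first, then pairs a < b ordered by b and then by a.
rank : Deletion n → ℕ
rank (single v) = toℕ v
rank {n} (pair a b) = n + toℕ (combine b a)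

rank-single<rank-pair : ∀ (v a b : Fin n) → rank (single v) < rank (pair a b)
rank-single<rank-pair {n} v a b = ℕ.<-≤-trans (Fin.toℕ<n v) (ℕ.m≤m+n n _)

rank<n+n*n : ∀ (d : Deletion n) → rank d < n + n * n
rank<n+n*n {n} (single v) = ℕ.<-≤-trans (Fin.toℕ<n v) (ℕ.m≤m+n n (n * n))
rank<n+n*n {n} (pair a b) = ℕ.+-monoʳ-< n (Fin.toℕ<n (combine b a))

rank-pair-max : ∀ {a b a' b' : Fin n} → rank (pair a' b') < rank (pair a b) → b' Fin.≤ b
rank-pair-max {n} {a} {b} {a'} {b'} ranked =
  ℕ.≮⇒≥ λ b<b' → ℕ.<-asym ranked (ℕ.+-monoʳ-< n (Fin.combine-monoˡ-< a a' b<b'))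

rank-injective : ∀ (d e : Deletion n) → rank d ≡ rank e → d ≡ e
rank-injective (single v) (single w) eq = cong single (Fin.toℕ-injective eq)
rank-injective (single v) (pair a b) eq = contradiction eq (ℕ.<⇒≢ (rank-single<rank-pair v a b))
rank-injective (pair a b) (single v) eq = contradiction (sym eq) (ℕ.<⇒≢ (rank-single<rank-pair v a b))
rank-injective {n} (pair a b) (pair a' b') eq
  with refl , refl ← Fin.combine-injective b a b' a' (Fin.toℕ-injective (ℕ.+-cancelˡ-≡ n _ _ eq)) = refl

module AllCodimensionTwoFaces {n} (Δ : Complex n) (¬Δ⊤ : ¬ Δ ⊤) (coface? : ∀ v → Dec (Δ (⊤ - v)))
                (ridge : ∀ a b → a ≢ b → Δ (⊤ - a - b)) where

  remaining : Deletion n → Subset n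
  remaining (single v) = ⊤ - v
  remaining (pair a b) = ⊤ - a - b

  Valid : Deletion n → Set
  Valid (single v) = Δ (⊤ - v)
  Valid (pair a b) = a Fin.< b × ¬ Δ (⊤ - a) × ¬ Δ (⊤ - b)

  valid? : ∀ d → Dec (Valid d)
  valid? (single v) = coface? v
  valid? (pair a b) = a Fin.<? b ×-dec ¬? (coface? a) ×-dec ¬? (coface? b)

  ¬⊤⊆face : ∀ {τ} → Δ τ → ¬ ⊤ ⊆ τ
  ¬⊤⊆face Δτ ⊤⊆τ = ¬Δ⊤ (subst Δ (⊆-antisym (λ _ → ∈⊤) ⊤⊆τ) Δτ)

  face-above-coface : ∀ {τ v} → Δ τ → ⊤ - v ⊆ τ → τ ≡ ⊤ - v
  face-above-coface {τ} {v} Δτ ⊤-v⊆τ with v ∈? τ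
  ... | yes v∈τ = ⊥-elim (¬⊤⊆face Δτ (⊆-insert ⊤-v⊆τ v∈τ))
  ... | no  v∉τ = ⊆-antisym (⊆⊤-x v∉τ) ⊤-v⊆τ

  face-above-ridge : ∀ {τ a b} → Δ τ → ¬ Δ (⊤ - a) → ¬ Δ (⊤ - b) →
                     ⊤ - a - b ⊆ τ → τ ≡ ⊤ - a - b
  face-above-ridge {τ} {a} {b} Δτ ¬Δa ¬Δb ⊤-a-b⊆τ with a ∈? τ | b ∈? τ
  ... | yes a∈τ | _ = contradiction (subst Δ (face-above-coface Δτ ⊤-b⊆τ) Δτ) ¬Δb
    where ⊤-b⊆τ = ⊆-insert (subst (_⊆ τ) (p─x─y≡p─y─x ⊤ a b) ⊤-a-b⊆τ) a∈τ
  ... | no _ | yes b∈τ =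
    contradiction (subst Δ (face-above-coface Δτ (⊆-insert ⊤-a-b⊆τ b∈τ)) Δτ) ¬Δa
  ... | no a∉τ | no b∉τ =
    ⊆-antisym (λ y∈τ → x∈p∧x≢y⇒x∈p-y (⊆⊤-x a∉τ y∈τ) λ { refl → b∉τ y∈τ }) ⊤-a-b⊆τ

  Valid⇒IsFacet : ∀ d → Valid d → IsFacet Δ (remaining d)
  Valid⇒IsFacet (single v) Δv = Δv , λ τ Δτ → face-above-coface Δτ
  Valid⇒IsFacet (pair a b) (a<b , ¬Δa , ¬Δb) =
    ridge a b (ℕ.<⇒≢ a<b ∘ cong toℕ) , λ τ Δτ → face-above-ridge Δτ ¬Δa ¬Δb

  IsFacet⇒Valid : ∀ σ → IsFacet Δ σ → ∃[ d ] (Valid d × remaining d ≡ σ)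
  IsFacet⇒Valid σ (Δσ , maximal) with ⊈⇒∃∉ (¬⊤⊆face Δσ)
  ... | a , _ , a∉σ with coface? a
  ...   | yes Δa = single a , Δa , maximal (⊤ - a) Δa (⊆⊤-x a∉σ)
  ...   | no ¬Δa with ⊈⇒∃∉ (λ ⊤-a⊆σ → ¬Δa (subst Δ (face-above-coface Δσ ⊤-a⊆σ) Δσ))
  ...     | b , b∈⊤-a , b∉σ = ordered (Fin.<-cmp a b)
    where
    σ⊆⊤-a-b : σ ⊆ ⊤ - a - b
    σ⊆⊤-a-b y∈σ = x∈p∧x≢y⇒x∈p-y (⊆⊤-x a∉σ y∈σ) λ { refl → b∉σ y∈σ }
    ⊤-a-b≡σ : ⊤ - a - b ≡ σ
    ⊤-a-b≡σ = maximal _ (ridge a b λ { refl → x∈p-y⇒x≢y b∈⊤-a refl }) σ⊆⊤-a-b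
    ¬Δb : ¬ Δ (⊤ - b)
    ¬Δb Δb = a∉σ (subst (a ∈_) (maximal (⊤ - b) Δb (⊆⊤-x b∉σ))
                        (∈⊤-x λ { refl → x∈p-y⇒x≢y b∈⊤-a refl }))
    ordered : _ → ∃[ d ] (Valid d × remaining d ≡ σ)
    ordered (tri< a<b _ _) = pair a b , (a<b , ¬Δa , ¬Δb) , ⊤-a-b≡σ
    ordered (tri≈ _ refl _) = contradiction refl (x∈p-y⇒x≢y b∈⊤-a)
    ordered (tri> _ _ b<a) = pair b a , (b<a , ¬Δb , ¬Δa) , trans (p─x─y≡p─y─x ⊤ b a) ⊤-a-b≡σ

  ExchangeWitness : Deletion n → Deletion n → Set
  ExchangeWitness d d' =
    ∃[ x ] (x ∈ remaining d × x ∉ remaining d' ×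
            ∃[ e ] (Valid e × rank e < rank d × remaining d - x ⊆ remaining e))

  new-vertex : ∀ {a b a' b' : Fin n} → a' Fin.< b' → rank (pair a' b') < rank (pair a b) →
               ∃[ x ] ((x ≡ a' ⊎ x ≡ b') × x ≢ a × x Fin.< b)
  new-vertex {a} {b} {a'} {b'} a'<b' ranked with a' Fin.≟ a
  ... | no a'≢a = a' , inj₁ refl , a'≢a , ℕ.<-≤-trans a'<b' (rank-pair-max ranked)
  ... | yes refl = b' , inj₂ refl , (λ { refl → ℕ.<-irrefl refl a'<b' }) ,
                   ℕ.≤∧≢⇒< (rank-pair-max ranked)
                     λ b'≡b → ℕ.<-irrefl (cong (rank ∘ pair a') (Fin.toℕ-injective b'≡b)) ranked

  earlier-pair : ∀ {a b x} → x ≢ a → x Fin.< b → a Fin.< b → ¬ Δ (⊤ - a) → ¬ Δ (⊤ - x) →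
                 ∃[ e ] (Valid e × rank e < rank (pair a b) × ⊤ - a - b - x ⊆ remaining e)
  earlier-pair {a} {b} {x} x≢a x<b a<b ¬Δa ¬Δx with Fin.<-cmp a x
  ... | tri< a<x _ _ = pair a x , (a<x , ¬Δa , ¬Δx) , ℕ.+-monoʳ-< n (Fin.combine-monoˡ-< a a x<b) ,
                       ⊆-drop-middle
  ... | tri≈ _ a≡x _ = contradiction (sym a≡x) x≢a
  ... | tri> _ _ x<a = pair x a , (x<a , ¬Δx , ¬Δa) , ℕ.+-monoʳ-< n (Fin.combine-monoˡ-< x a a<b) ,
                       subst (⊤ - a - b - x ⊆_) (p─x─y≡p─y─x ⊤ a x) ⊆-drop-middle

  valid-exchange : ∀ d d' → Valid d → Valid d' → rank d' < rank d → ExchangeWitness d d'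
  valid-exchange (single v) (single w) _ Δw w<v =
    w , ∈⊤-x (λ { refl → ℕ.<-irrefl refl w<v }) , (λ w∈ → x∈p-y⇒x≢y w∈ refl) ,
    single w , Δw , w<v , ∈⊤-x ∘ x∈p-y⇒x≢y
  valid-exchange (single v) (pair a b) _ _ ranked = contradiction ranked (ℕ.<-asym (rank-single<rank-pair v a b))
  valid-exchange (pair a b) (single w) (_ , ¬Δa , ¬Δb) Δw _ =
    w , ∈⊤-x-y (λ { refl → ¬Δa Δw }) (λ { refl → ¬Δb Δw }) , (λ w∈ → x∈p-y⇒x≢y w∈ refl) ,
    single w , Δw , rank-single<rank-pair w a b , ∈⊤-x ∘ x∈p-y⇒x≢y
  valid-exchange (pair a b) (pair a' b') (a<b , ¬Δa , _) (a'<b' , ¬Δa' , ¬Δb') ranked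
    with new-vertex a'<b' ranked
  ... | x , x∈a'b' , x≢a , x<b with earlier-pair x≢a x<b a<b ¬Δa (¬Δx x∈a'b')
    where
    ¬Δx : (x ≡ a' ⊎ x ≡ b') → ¬ Δ (⊤ - x)
    ¬Δx (inj₁ refl) = ¬Δa'
    ¬Δx (inj₂ refl) = ¬Δb'
  ... | e , earlier =
    x , ∈⊤-x-y x≢a (λ { refl → ℕ.<-irrefl refl x<b }) , x∉ x∈a'b' , e , earlier
    where
    x∉ : (x ≡ a' ⊎ x ≡ b') → x ∉ ⊤ - a' - b'
    x∉ (inj₁ refl) x∈ = x∈p-y⇒x≢y (x∈p-y⇒x∈p x∈) refl
    x∉ (inj₂ refl) x∈ = x∈p-y⇒x≢y x∈ refl

  Ranked : ℕ → Set
  Ranked m = ∃[ d ] (Valid d × rank d ≡ m)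

  ranked? : ∀ m → Dec (Ranked m)
  ranked? m = any-Deletion? (λ d → valid? d ×-dec rank d ℕ.≟ m)

  open IncreasingEnumeration ranked? (n + n * n)

  deletion : Fin size → Deletion n
  deletion i = proj₁ (nth-satisfies i)

  facet : Fin size → Subset n
  facet = remaining ∘ deletion

  deletion-valid : ∀ i → Valid (deletion i)
  deletion-valid i = proj₁ (proj₂ (nth-satisfies i))

  rank-deletion : ∀ i → rank (deletion i) ≡ nth i
  rank-deletion i = proj₂ (proj₂ (nth-satisfies i))

  deletion-increasing : ∀ {i j} → toℕ i < toℕ j → rank (deletion i) < rank (deletion j)
  deletion-increasing {i} {j} i<j =
    subst₂ _<_ (sym (rank-deletion i)) (sym (rank-deletion j)) (nth-strictlyIncreasing i<j)

  deletion-reflects-rank : ∀ {i j} → rank (deletion i) < rank (deletion j) → toℕ i < toℕ j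
  deletion-reflects-rank {i} {j} ranked with Fin.<-cmp i j
  ... | tri< i<j _ _ = i<j
  ... | tri≈ _ refl _ = contradiction ranked (ℕ.<-irrefl refl)
  ... | tri> _ _ j<i = contradiction ranked (ℕ.<-asym (deletion-increasing j<i))

  deletion-surjective : ∀ {d} → Valid d → ∃[ i ] deletion i ≡ d
  deletion-surjective {d} valid with nth-surjective (d , valid , refl) (rank<n+n*n d)
  ... | i , nth-i≡rank-d = i , rank-injective _ _ (trans (rank-deletion i) nth-i≡rank-d)

  facet-exchange : Exchange facet
  facet-exchange {j} {k} j<k
    with valid-exchange (deletion k) (deletion j) (deletion-valid k) (deletion-valid j) (deletion-increasing j<k)
  ... | x , x∈Fk , x∉Fj , e , valid-e , e<k , Fk-x⊆e with deletion-surjective {e} valid-e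
  ... | i , dᵢ≡e = x , x∈Fk , x∉Fj , i ,
    deletion-reflects-rank (subst (λ d → rank d < _) (sym dᵢ≡e) e<k) ,
    subst (λ d → facet k - x ⊆ remaining d) (sym dᵢ≡e) Fk-x⊆e

  facet-complete : ∀ σ → IsFacet Δ σ → ∃[ i ] facet i ≡ σ
  facet-complete σ σ-facet with IsFacet⇒Valid σ σ-facet
  ... | d , valid , d≡σ with deletion-surjective {d} valid
  ... | i , dᵢ≡d = i , trans (cong remaining dᵢ≡d) d≡σ

  shellable : Shellable Δ
  shellable = size , facet ,
    Exchange⇒IsShelling (λ i → Valid⇒IsFacet (deletion i) (deletion-valid i)) facet-complete facet-exchange

theorem4p4 : (n : ℕ) → (G : SimpleGraph n) → (r : ℕ) → 3 ≤ n → n ∸ 2 ≤ r → r ≤ n ∸ 1 →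
    Shellable (Ind G r)
theorem4p4 n G r _ n∸2≤r _ with RIndependent? G r ⊤
... | yes Δ⊤  = ⊤-face⇒Shellable Δ⊤
... | no  ¬Δ⊤ = AllCodimensionTwoFaces.shellable (Ind G r) ¬Δ⊤ (λ v → RIndependent? G r (⊤ - v)) ridge
  where
  ridge : ∀ a b → a ≢ b → Ind G r (⊤ - a - b)
  ridge a b a≢b = ∣A∣≤r⇒RIndependent G (subst (_≤ r) (sym (∣⊤-x-y∣≡n∸2 a≢b)) n∸2≤r)
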